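{- Let $G=(V,E)$ be a connected finite undirected graph and $p$ an integer with $2\le p\le|V|$ such that $G$ is not universally solvable for $p$ robots. Then there are at least $|\mathcal S_G|/2$ distinct configurations $S\in\mathcal S_G$ such that $S$ is not reachable from the identity configuration $S_I$.
   Context: Robots are $R=[p]=\{1,\dots,p\}$. A configuration is an injective map $S:R\to V$; $\mathcal S_G$ is the set of all configurations. A pair $(S,S')$ of configurations is a valid move if it is one of: (i) a simple path move: there is a simple path $(u_0,\dots,u_k)$ in $G$ with $u_k\notin S(R)$, $u_0\notin S'(R)$, $S'(i)=S(i)$ for robots not on the path, and $S'(i)=u_{j+1}$ whenever $S(i)=u_j$, $0\le j\le k-1$; (ii) a simple rotation move: there is a simple cycle $(u_0,\dots,u_{k-1},u_k=u_0)$ in $G$ all of whose vertices are occupied in $S$ and in $S'$, robots off the cycle stay fixed, and $S'(i)=u_{j+1}$ whenever $S(i)=u_j$; (iii) a dummy move $(S,S)$. $T$ is reachable from $S$ if there is a finite sequence $S=S_0,\dots,S_t=T$ with each $(S_{k-1},S_k)$ a valid move. $G$ is universally solvable for $p$ robots if every configuration is reachable from every other. Fix a total order on $V$ and let $v_1,\dots,v_n$ be the order in which breadth-first search, started at the least vertex and exploring neighbours in increasing order, visits the vertices of $G$. The identity configuration is $S_I(i)=v_i$ for $i\in[p]$. -}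

module Defs where

open import Data.Nat using (ℕ; zero; suc; _≤_; _*_)
open import Data.Fin using (Fin; zero; suc; fromℕ; inject₁; inject≤; toℕ; _≟_)
open import Data.List using (List; []; _∷_; _++_; filterᵇ; length)
open import Data.List.Relation.Unary.All using (All)
open import Data.List.Relation.Unary.Unique.Propositional using (Unique)
open import Data.List using (allFin) 
open import Data.Vec using (Vec; lookup; tabulate)
open import Data.Bool using (Bool; true; false; T; if_then_else_)
open import Data.Maybe using (Maybe; just; nothing; fromMaybe)
import Data.Maybe as Maybe
open import Data.Product using (Σ; ∃; _×_; _,_)
open import Data.Sum using (_⊎_)
open import Relation.Binary.PropositionalEquality using (_≡_; _≢_)
open import Relation.Binary.Construct.Closure.ReflexiveTransitive using (Star)
open import Relation.Nullary using (¬_; does)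

-- Finite simple undirected graphs on the vertex set V = Fin n.
-- The fixed total order on V is the natural order of Fin n.

record Graph : Set where
  field
    n     : ℕ
    adj   : Fin n → Fin n → Bool
    sym   : ∀ u v → adj u v ≡ adj v u
    irrefl : ∀ u → adj u u ≡ false

  Adj : Fin n → Fin n → Set
  Adj u v = T (adj u v)

open Graph public

Connected : Graph → Set
Connected G = ∀ u v → Star (Adj G) u v

Config : Graph → ℕ → Set
Config G p = Vec (Fin (n G)) p

IsConfig : (G : Graph) {p : ℕ} → Config G p → Set
IsConfig G {p} S = ∀ (i j : Fin p) → lookup S i ≡ lookup S j → i ≡ j

-- Cyclic successor on Fin (suc m): j ↦ j+1 mod (suc m).

step : ∀ {m} → Fin (suc m) → Maybe (Fin (suc m))
step {zero}  zero    = nothing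
step {suc m} zero    = just (suc zero)
step {suc m} (suc j) = Maybe.map suc (step j)

next : ∀ {m} → Fin (suc m) → Fin (suc m)
next j = fromMaybe zero (step j)

record PathMove (G : Graph) {p : ℕ} (S S' : Config G p) : Set where
  field
    k       : ℕ
    u       : Fin (suc k) → Fin (n G)
    simple  : ∀ a b → u a ≡ u b → a ≡ b
    edges   : ∀ (j : Fin k) → Adj G (u (inject₁ j)) (u (suc j))
    endFree : ∀ i → lookup S i ≢ u (fromℕ k)
    startFree : ∀ i → lookup S' i ≢ u zero
    offPath : ∀ i → (∀ j → lookup S i ≢ u j) → lookup S' i ≡ lookup S i
    onPath  : ∀ i (j : Fin k) → lookup S i ≡ u (inject₁ j) → lookup S' i ≡ u (suc j)

-- (ii) simple rotation move along the simple cycle (u 0, …, u (k-1), u 0),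
-- k = m + 3 ≥ 3 (a simple cycle in a simple graph).
record RotationMove (G : Graph) {p : ℕ} (S S' : Config G p) : Set where
  field
    m       : ℕ
    u       : Fin (suc (suc (suc m))) → Fin (n G)
    simple  : ∀ a b → u a ≡ u b → a ≡ b
    edges   : ∀ j → Adj G (u j) (u (next j))
    occ     : ∀ j → ∃ λ i → lookup S i ≡ u j
    occ'    : ∀ j → ∃ λ i → lookup S' i ≡ u j
    offCycle : ∀ i → (∀ j → lookup S i ≢ u j) → lookup S' i ≡ lookup S i
    onCycle  : ∀ i j → lookup S i ≡ u j → lookup S' i ≡ u (next j)

data ValidMove (G : Graph) {p : ℕ} (S S' : Config G p) : Set where
  pathMove : IsConfig G S → IsConfig G S' → PathMove G S S' → ValidMove G S S'
  rotMove  : IsConfig G S → IsConfig G S' → RotationMove G S S' → ValidMove G S S'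
  dummy    : IsConfig G S → S ≡ S' → ValidMove G S S'

Reachable : (G : Graph) {p : ℕ} → Config G p → Config G p → Set
Reachable G S T = Star (ValidMove G) S T

UniversallySolvable : Graph → ℕ → Set
UniversallySolvable G p =
  ∀ (S T : Config G p) → IsConfig G S → IsConfig G T → Reachable G S T

module BFS (G : Graph) where
  V = Fin (n G)

  mem : V → List V → Bool
  mem v []       = false
  mem v (w ∷ ws) = if does (v ≟ w) then true else mem v ws

  neighbours : V → List V
  neighbours u = filterᵇ (adj G u) (allFin (n G))

  add : List V → List V → List V × List V
  add []       vis = vis , []
  add (v ∷ vs) vis with mem v vis
  ... | true  = add vs vis
  ... | false with add vs (vis ++ (v ∷ []))
  ...   | vis' , new = vis' , (v ∷ new)

  -- fuel bounds the number of dequeued vertices (≤ |V|)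
  run : ℕ → List V → List V → List V
  run zero    q        vis = vis
  run (suc f) []       vis = vis
  run (suc f) (u ∷ q)  vis with add (neighbours u) vis
  ... | vis' , new = run f (q ++ new) vis'

  orderFrom : V → List V
  orderFrom v₀ = run (n G) (v₀ ∷ []) (v₀ ∷ [])

nth : {A : Set} → List A → ℕ → Maybe A
nth []       _       = nothing
nth (x ∷ xs) zero    = just x
nth (x ∷ xs) (suc i) = nth xs i

-- the least vertex of Fin n (given that Fin n is inhabited)
least : ∀ {n} → Fin n → Fin n
least {suc _} _ = zero

-- BFS order v₁,…,vₙ from the least vertex (indices from 0 here)
bfsOrder : (G : Graph) → Fin (n G) → List (Fin (n G))
bfsOrder G v = BFS.orderFrom G (least v)

-- Identity configuration S_I(i) = v_i for i ∈ [p].  (For a connected G the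
-- BFS order lists all |V| ≥ p vertices, so the fallback is never used.)
identityConfig : (G : Graph) (p : ℕ) → p ≤ n G → Config G p
identityConfig G p p≤n =
  tabulate λ i → fromMaybe (inject≤ i p≤n) (nth (bfsOrder G (inject≤ i p≤n)) (toℕ i))

-- Moves are reversible, so reachability is an equivalence relation on configurations, and
-- relabelling the robots by a permutation τ (S ↦ S ∘ τ) maps moves to moves.  Since G is
-- connected, sliding one robot at a time along walks drives every configuration to one that
-- occupies exactly the vertices of S_I, i.e. to some S_I ∘ τ.  If all of these were reachable
-- from S_I, G would be universally solvable; so some S_I ∘ τ is not, and then S ↦ S ∘ τ maps the
-- configurations reachable from S_I injectively into the unreachable ones.  Reachability is
-- decidable (there are finitely many configurations and moves are decidable), which is what
-- lets us list the two classes.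
module Submission where

open import Defs hiding (sym)
open import Data.Nat using (ℕ; zero; suc; _≤_; _<_; _+_; _*_; z≤n)
open import Data.Nat.Properties
  using ( anyUpTo?; m≤n+m; m≤m+n; ≤-refl; ≤-trans; ≤-reflexive; <⇒≱; +-suc; +-identityʳ; +-monoˡ-≤; 1+n≰n
        ; module ≤-Reasoning)
open import Data.Fin using (Fin; zero; suc; punchOut; fromℕ; inject₁; opposite) renaming (_≟_ to _≟ᶠ_)
open import Data.Fin.Properties
  using (any?; all?; ¬∀⟶∃¬; punchOut-injective; injective⇒≤; 0≢1+n; suc-injective; opposite-involutive)
open import Data.Fin.Relation.Unary.Top using (view; ‵fromℕ; ‵inject₁)
open import Data.Maybe using (just; nothing; fromMaybe)
import Data.Maybe as Maybe
import Data.Vec.Functional as Fun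
open import Data.Vec.Functional.Properties using (∷-cong)
open import Data.Vec using (Vec; []; _∷_; lookup; tabulate; _[_]≔_)
open import Data.Vec.Properties using (∷-injective; lookup∘tabulate; ≡-dec; lookup∘update; lookup∘update′)
open import Data.Vec.Relation.Binary.Pointwise.Extensional using (ext; Pointwise-≡⇒≡)
open import Data.List using (List; []; _∷_; length; filter; map; cartesianProductWith; allFin)
open import Data.List.Properties using (filter-notAll; filter-all; length-map)
open import Data.List.Relation.Unary.Any using (Any; here; there)
import Data.List.Relation.Unary.Any as Any
open import Data.List.Relation.Unary.All using (All; []; _∷_)
import Data.List.Relation.Unary.All as All
open import Data.List.Membership.Propositional using (_∈_; _∉_; find)
open import Data.List.Membership.Propositional.Properties
  using (∈-filter⁺; ∈-filter⁻; ∈-map⁻; ∈-cartesianProductWith⁺; ∈-allFin)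
open import Data.List.Relation.Binary.Subset.Propositional using (_⊆_)
open import Data.List.Relation.Unary.Unique.Propositional using (Unique; []; _∷_)
open import Data.List.Relation.Unary.Unique.Propositional.Properties
  using (filter⁺; map⁺; cartesianProductWith⁺; allFin⁺)
open import Data.Product using (Σ; ∃; _×_; _,_; proj₁; proj₂)
open import Data.Sum using (_⊎_; inj₁; inj₂)
open import Data.Bool using (T)
open import Function using (_∘_)
open import Level using (0ℓ)
open import Function.Definitions using (Injective; StrictlySurjective)
open import Relation.Nullary using (¬_; Dec; yes; no; ¬?; contradiction)
open import Relation.Nullary.Decidable using (_×-dec_; _⊎-dec_; _→-dec_; T?)
import Relation.Nullary.Decidable as Dec
open import Relation.Unary using (Pred; Decidable)
open import Relation.Unary.Properties using (∁?)
open import Relation.Binary.Definitions using (DecidableEquality)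
open import Relation.Binary.PropositionalEquality
  using (_≡_; _≢_; _≗_; refl; sym; trans; cong; subst; subst₂; module ≡-Reasoning)
open import Relation.Binary.Construct.Closure.ReflexiveTransitive using (Star; ε; _◅_; _◅◅_)
import Relation.Binary.Construct.Closure.ReflexiveTransitive as Star

-- Finite combinatorics

module _ {A : Set} (_≟_ : DecidableEquality A) where

  Unique⇒length≤ : ∀ {xs ys : List A} → Unique xs → xs ⊆ ys → length xs ≤ length ys
  Unique⇒length≤ {[]}     _            _     = z≤n
  Unique⇒length≤ {x ∷ xs} {ys} (x∉xs ∷ xs!) xs⊆ys = begin-strict
    length xs                         ≤⟨ Unique⇒length≤ xs! xs⊆ys-x ⟩
    length (filter (¬? ∘ (x ≟_)) ys) <⟨ filter-notAll (¬? ∘ (x ≟_)) ys x∈ys ⟩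
    length ys                         ∎
    where
      open ≤-Reasoning
      xs⊆ys-x : xs ⊆ filter (¬? ∘ (x ≟_)) ys
      xs⊆ys-x y∈xs = ∈-filter⁺ (¬? ∘ (x ≟_)) (xs⊆ys (there y∈xs)) (All.lookup x∉xs y∈xs)
      x∈ys : Any (λ y → ¬ ¬ x ≡ y) ys
      x∈ys = Any.map (λ x≡y x≢y → x≢y x≡y) (xs⊆ys (here refl))

module _ {A : Set} {P : Pred A 0ℓ} (P? : Decidable P) where

  length-filter+length-filter-∁ : ∀ xs → length (filter P? xs) + length (filter (∁? P?) xs) ≡ length xs
  length-filter+length-filter-∁ []       = refl
  length-filter+length-filter-∁ (x ∷ xs) with P? x
  ... | yes _ = cong suc (length-filter+length-filter-∁ xs)
  ... | no  _ = trans (+-suc _ _) (cong suc (length-filter+length-filter-∁ xs))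

  length≤2*length-filter-∁ : DecidableEquality A → (f : A → A) → Injective _≡_ _≡_ f →
    ∀ {xs} → Unique xs → (∀ {x} → x ∈ xs → P x → f x ∈ xs × ¬ P (f x)) →
    length xs ≤ 2 * length (filter (∁? P?) xs)
  length≤2*length-filter-∁ _≟_ f f-inj {xs} xs! f-swaps = begin
    length xs                 ≡⟨ sym (length-filter+length-filter-∁ xs) ⟩
    length inP + length outP  ≤⟨ +-monoˡ-≤ (length outP) inP≤outP ⟩
    length outP + length outP ≡⟨ cong (length outP +_) (sym (+-identityʳ (length outP))) ⟩
    2 * length outP           ∎
    where
      open ≤-Reasoning
      inP  = filter P? xs
      outP = filter (∁? P?) xs
      f[inP]⊆outP : map f inP ⊆ outP
      f[inP]⊆outP y∈ with ∈-map⁻ f y∈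
      ... | x , x∈inP , refl with ∈-filter⁻ P? x∈inP
      ...   | x∈xs , Px = ∈-filter⁺ (∁? P?) (proj₁ (f-swaps x∈xs Px)) (proj₂ (f-swaps x∈xs Px))
      inP≤outP : length inP ≤ length outP
      inP≤outP = subst (_≤ length outP) (length-map f inP)
        (Unique⇒length≤ _≟_ (map⁺ f-inj (filter⁺ P? xs!)) f[inP]⊆outP)

injective⇒strictlySurjective : ∀ {m} {f : Fin m → Fin m} →
                               Injective _≡_ _≡_ f → StrictlySurjective _≡_ f
injective⇒strictlySurjective {zero}  f-inj ()
injective⇒strictlySurjective {suc m} {f} f-inj y with any? (λ x → f x ≟ᶠ y)
... | yes hit = hit
... | no  miss = contradiction (injective⇒≤ g-inj) 1+n≰n
  where
    g : Fin (suc m) → Fin m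
    g x = punchOut {i = y} (λ y≡fx → miss (x , sym y≡fx))
    g-inj : Injective _≡_ _≡_ g
    g-inj = f-inj ∘ punchOut-injective {i = y} _ _

anyFunction? : ∀ {N} m {P : (Fin m → Fin N) → Set} → (∀ {f g} → f ≗ g → P f → P g) →
               (∀ f → Dec (P f)) → Dec (∃ P)
anyFunction? zero P-resp P? =
  Dec.map′ (λ Pf → _ , Pf) (λ (f , Pf) → P-resp (λ ()) Pf) (P? (λ ()))
anyFunction? (suc m) P-resp P? =
  Dec.map′ (λ (a , f , Pa∷f) → a Fun.∷ f , Pa∷f)
           (λ (f , Pf) → Fun.head f , Fun.tail f , P-resp (∷-cong refl λ _ → refl) Pf)
           (any? λ a → anyFunction? m (P-resp ∘ ∷-cong refl) (P? ∘ (a Fun.∷_)))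

allVecs : {A : Set} → List A → ∀ m → List (Vec A m)
allVecs xs zero    = [] ∷ []
allVecs xs (suc m) = cartesianProductWith _∷_ xs (allVecs xs m)

∈-allVecs : {A : Set} {xs : List A} → (∀ x → x ∈ xs) → ∀ {m} (v : Vec A m) → v ∈ allVecs xs m
∈-allVecs ∈xs []      = here refl
∈-allVecs ∈xs (x ∷ v) = ∈-cartesianProductWith⁺ _∷_ (∈xs x) (∈-allVecs ∈xs v)

Unique-allVecs : {A : Set} {xs : List A} → Unique xs → ∀ m → Unique (allVecs xs m)
Unique-allVecs xs! zero    = [] ∷ []
Unique-allVecs xs! (suc m) = cartesianProductWith⁺ _∷_ ∷-injective xs! (Unique-allVecs xs! m)

module _ {A : Set} (_≟_ : DecidableEquality A) {R : A → A → Set} (R? : ∀ x y → Dec (R x y))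
         (E : List A) (R⊆E : ∀ {x y} → R x y → y ∈ E) (s : A) where

  open import Data.List.Membership.DecPropositional _≟_ using (_∈?_)

  private
    record Visited (K : List A) : Set where
      field
        start   : s ∈ K
        unique  : Unique K
        bounded : K ⊆ s ∷ E
        reached : ∀ {y} → y ∈ K → Star R s y

    Closed : List A → Set
    Closed K = ∀ {x y} → x ∈ K → R x y → y ∈ K

    Closed-Star : ∀ {K} → Closed K → ∀ {x y} → x ∈ K → Star R x y → y ∈ K
    Closed-Star closed x∈K ε        = x∈K
    Closed-Star closed x∈K (r ◅ rs) = Closed-Star closed (closed x∈K r) rs

    Exit : List A → A → Set
    Exit K y = y ∉ K × Any (λ x → R x y) K

    exit? : ∀ K y → Dec (Exit K y)
    exit? K y = ¬? (y ∈? K) ×-dec Any.any? (λ x → R? x y) K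

    extend : ∀ {K y} → Visited K → y ∈ E → Exit K y → Visited (y ∷ K)
    extend {K} {y} vis y∈E (y∉K , R[K,y]) with x , x∈K , Rxy ← find R[K,y] = record
      { start   = there start
      ; unique  = All.tabulate (λ z∈K y≡z → y∉K (subst (_∈ K) (sym y≡z) z∈K)) ∷ unique
      ; bounded = λ { (here refl) → there y∈E ; (there z∈K) → bounded z∈K }
      ; reached = λ { (here refl) → reached x∈K ◅◅ Rxy ◅ ε ; (there z∈K) → reached z∈K }
      }
      where open Visited vis

    -- K stays duplicate-free inside s ∷ E, so it cannot outgrow s ∷ E: the fuel never runs out.
    explore : ∀ fuel K → Visited K → length (s ∷ E) < length K + fuel → ∃ λ K → Visited K × Closed K
    explore zero K vis overfull =
      contradiction (Unique⇒length≤ _≟_ unique bounded)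
                    (<⇒≱ (subst (length (s ∷ E) <_) (+-identityʳ (length K)) overfull))
      where open Visited vis
    explore (suc fuel) K vis room with Any.any? (exit? K) E
    ... | yes exits with y , y∈E , exit ← find exits =
      explore fuel (y ∷ K) (extend vis y∈E exit) (subst (length (s ∷ E) <_) (+-suc (length K) fuel) room)
    ... | no noExit = K , vis , closed
      where
        closed : Closed K
        closed {x} {y} x∈K Rxy with y ∈? K
        ... | yes y∈K = y∈K
        ... | no  y∉K =
          contradiction (Any.map (λ { refl → y∉K , Any.map (λ { refl → Rxy }) x∈K }) (R⊆E Rxy)) noExit

    start-visited : Visited (s ∷ [])
    start-visited = record
      { start   = here refl
      ; unique  = [] ∷ []
      ; bounded = λ { (here refl) → here refl }
      ; reached = λ { (here refl) → ε }
      }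

  Star? : ∀ t → Dec (Star R s t)
  Star? t with K , vis , closed ← explore (length (s ∷ E)) (s ∷ []) start-visited ≤-refl =
    Dec.map′ (Visited.reached vis) (Closed-Star closed (Visited.start vis)) (t ∈? K)

-- Reversing moves

step-inject₁ : ∀ {k} (j : Fin k) → step (inject₁ j) ≡ just (suc j)
step-inject₁ {suc k} zero    = refl
step-inject₁ {suc k} (suc j) = cong (Maybe.map suc) (step-inject₁ j)

step-fromℕ : ∀ k → step (fromℕ k) ≡ nothing
step-fromℕ zero    = refl
step-fromℕ (suc k) = cong (Maybe.map suc) (step-fromℕ k)

next-inject₁ : ∀ {k} (j : Fin k) → next (inject₁ j) ≡ suc j
next-inject₁ j = cong (fromMaybe zero) (step-inject₁ j)

next-fromℕ : ∀ k → next (fromℕ k) ≡ zero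
next-fromℕ k = cong (fromMaybe zero) (step-fromℕ k)

next-injective : ∀ {k} → Injective _≡_ _≡_ (next {k})
next-injective {k} {a} {b} eq with view a | view b
... | ‵fromℕ     | ‵fromℕ     = refl
... | ‵fromℕ     | ‵inject₁ j =
  contradiction (trans (sym (next-fromℕ k)) (trans eq (next-inject₁ j))) 0≢1+n
... | ‵inject₁ i | ‵fromℕ     =
  contradiction (trans (sym (next-fromℕ k)) (trans (sym eq) (next-inject₁ i))) 0≢1+n
... | ‵inject₁ i | ‵inject₁ j =
  cong inject₁ (suc-injective (trans (sym (next-inject₁ i)) (trans eq (next-inject₁ j))))

opposite-inject₁ : ∀ {k} (i : Fin k) → opposite (inject₁ i) ≡ suc (opposite i)
opposite-inject₁ {suc k} zero    = refl
opposite-inject₁ {suc k} (suc i) = cong inject₁ (opposite-inject₁ i)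

opposite-fromℕ : ∀ k → opposite (fromℕ k) ≡ zero
opposite-fromℕ zero    = refl
opposite-fromℕ (suc k) = cong inject₁ (opposite-fromℕ k)

opposite-injective : ∀ {k} → Injective _≡_ _≡_ (opposite {k})
opposite-injective {x = a} {b} eq = begin
  a                       ≡⟨ opposite-involutive a ⟨
  opposite (opposite a)   ≡⟨ cong opposite eq ⟩
  opposite (opposite b)   ≡⟨ opposite-involutive b ⟩
  b                       ∎
  where open ≡-Reasoning

next∘opposite∘next : ∀ {k} (j : Fin (suc k)) → next (opposite (next j)) ≡ opposite j
next∘opposite∘next {k} j with view j
... | ‵fromℕ = begin
  next (opposite (next (fromℕ k)))   ≡⟨ cong (next ∘ opposite) (next-fromℕ k) ⟩
  next (fromℕ k)                     ≡⟨ next-fromℕ k ⟩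
  zero                               ≡⟨ opposite-fromℕ k ⟨
  opposite (fromℕ k)                 ∎
  where open ≡-Reasoning
... | ‵inject₁ i = begin
  next (opposite (next (inject₁ i))) ≡⟨ cong (next ∘ opposite) (next-inject₁ i) ⟩
  next (inject₁ (opposite i))        ≡⟨ next-inject₁ (opposite i) ⟩
  suc (opposite i)                   ≡⟨ opposite-inject₁ i ⟨
  opposite (inject₁ i)               ∎
  where open ≡-Reasoning

module _ (G : Graph) where

  Adj-sym : ∀ {x y} → Adj G x y → Adj G y x
  Adj-sym {x} {y} = subst T (Graph.sym G x y)

  Adj⇒≢ : ∀ {x y} → Adj G x y → x ≢ y
  Adj⇒≢ {x} xy refl = subst T (irrefl G x) xy

  module _ {p : ℕ} {S S′ : Config G p} where

    PathMove-reverse : PathMove G S S′ → PathMove G S′ S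
    PathMove-reverse pm = record
      { k         = k
      ; u         = u ∘ opposite
      ; simple    = λ a b → opposite-injective ∘ simple _ _
      ; edges     = edges′
      ; endFree   = λ i e → startFree i (trans e (cong u (opposite-fromℕ k)))
      ; startFree = endFree
      ; offPath   = offPath′
      ; onPath    = onPath′
      }
      where
        open PathMove pm

        edges′ : ∀ (j : Fin k) → Adj G (u (opposite (inject₁ j))) (u (opposite (suc j)))
        edges′ j = subst (λ z → Adj G (u z) (u (opposite (suc j)))) (sym (opposite-inject₁ j))
                         (Adj-sym (edges (opposite j)))

        fate : ∀ i → (∃ λ a → lookup S i ≡ u (inject₁ a) × lookup S′ i ≡ u (suc a))
                   ⊎ ((∀ j → lookup S i ≢ u j) × lookup S′ i ≡ lookup S i)
        fate i with any? (λ a → lookup S i ≟ᶠ u a)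
        ... | no off = inj₂ (off′ , offPath i off′) where off′ = λ j e → off (j , e)
        ... | yes (a , on) with view a
        ...   | ‵fromℕ      = contradiction on (endFree i)
        ...   | ‵inject₁ a′ = inj₁ (a′ , on , onPath i a′ on)

        offPath′ : ∀ i → (∀ j → lookup S′ i ≢ u (opposite j)) → lookup S i ≡ lookup S′ i
        offPath′ i off′ with fate i
        ... | inj₁ (a , _ , moved) =
          contradiction (trans moved (cong u (sym (opposite-involutive (suc a))))) (off′ (opposite (suc a)))
        ... | inj₂ (_ , stayed) = sym stayed

        onPath′ : ∀ i (j : Fin k) → lookup S′ i ≡ u (opposite (inject₁ j)) →
                  lookup S i ≡ u (opposite (suc j))
        onPath′ i j on′ with fate i
        ... | inj₁ (a , on , moved) = subst (λ b → lookup S i ≡ u (inject₁ b)) a≡ on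
          where
            a≡ : a ≡ opposite j
            a≡ = suc-injective (simple _ _ (trans (sym moved) (trans on′ (cong u (opposite-inject₁ j)))))
        ... | inj₂ (off , stayed) = contradiction (trans (sym stayed) on′) (off (opposite (inject₁ j)))

    RotationMove-reverse : RotationMove G S S′ → RotationMove G S′ S
    RotationMove-reverse rm = record
      { m        = m
      ; u        = u ∘ opposite
      ; simple   = λ a b → opposite-injective ∘ simple _ _
      ; edges    = edges′
      ; occ      = occ' ∘ opposite
      ; occ'     = occ ∘ opposite
      ; offCycle = offCycle′
      ; onCycle  = onCycle′
      }
      where
        open RotationMove rm

        edges′ : ∀ j → Adj G (u (opposite j)) (u (opposite (next j)))
        edges′ j = Adj-sym (subst (λ z → Adj G (u (opposite (next j))) (u z)) (next∘opposite∘next j)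
                                  (edges (opposite (next j))))

        fate : ∀ i → (∃ λ a → lookup S i ≡ u a × lookup S′ i ≡ u (next a))
                   ⊎ ((∀ j → lookup S i ≢ u j) × lookup S′ i ≡ lookup S i)
        fate i with any? (λ a → lookup S i ≟ᶠ u a)
        ... | no off       = inj₂ (off′ , offCycle i off′) where off′ = λ j e → off (j , e)
        ... | yes (a , on) = inj₁ (a , on , onCycle i a on)

        offCycle′ : ∀ i → (∀ j → lookup S′ i ≢ u (opposite j)) → lookup S i ≡ lookup S′ i
        offCycle′ i off′ with fate i
        ... | inj₁ (a , _ , moved) =
          contradiction (trans moved (cong u (sym (opposite-involutive (next a))))) (off′ (opposite (next a)))
        ... | inj₂ (_ , stayed) = sym stayed

        onCycle′ : ∀ i j → lookup S′ i ≡ u (opposite j) → lookup S i ≡ u (opposite (next j))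
        onCycle′ i j on′ with fate i
        ... | inj₁ (a , on , moved) = subst (λ b → lookup S i ≡ u b) a≡ on
          where
            a≡ : a ≡ opposite (next j)
            a≡ = next-injective (trans (simple _ _ (trans (sym moved) on′)) (sym (next∘opposite∘next j)))
        ... | inj₂ (off , stayed) = contradiction (trans (sym stayed) on′) (off (opposite j))

    ValidMove-reverse : ValidMove G S S′ → ValidMove G S′ S
    ValidMove-reverse (pathMove c c′ pm) = pathMove c′ c (PathMove-reverse pm)
    ValidMove-reverse (rotMove c c′ rm)  = rotMove c′ c (RotationMove-reverse rm)
    ValidMove-reverse (dummy c refl)     = dummy c refl

    ValidMove-target : ValidMove G S S′ → IsConfig G S′
    ValidMove-target (pathMove _ c′ _) = c′
    ValidMove-target (rotMove _ c′ _)  = c′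
    ValidMove-target (dummy c refl)    = c

  Reachable-sym : ∀ {p} {S S′ : Config G p} → Reachable G S S′ → Reachable G S′ S
  Reachable-sym = Star.reverse ValidMove-reverse

  Reachable-IsConfig : ∀ {p} {S S′ : Config G p} → IsConfig G S → Reachable G S S′ → IsConfig G S′
  Reachable-IsConfig c ε          = c
  Reachable-IsConfig c (mv ◅ mvs) = Reachable-IsConfig (ValidMove-target mv) mvs

-- Relabelling the robots

module _ (G : Graph) {p : ℕ} where

  Occupied : Config G p → Fin (n G) → Set
  Occupied S v = ∃ λ i → lookup S i ≡ v

  occupied? : ∀ S v → Dec (Occupied S v)
  occupied? S v = any? (λ i → lookup S i ≟ᶠ v)

  relabel : Config G p → (Fin p → Fin p) → Config G p
  relabel S τ = tabulate (lookup S ∘ τ)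

  lookup-relabel : ∀ S τ i → lookup (relabel S τ) i ≡ lookup S (τ i)
  lookup-relabel S τ = lookup∘tabulate (lookup S ∘ τ)

  IsConfig-relabel : ∀ {τ} → Injective _≡_ _≡_ τ → ∀ {S} → IsConfig G S → IsConfig G (relabel S τ)
  IsConfig-relabel {τ} τ-inj {S} c i j e =
    τ-inj (c (τ i) (τ j) (trans (sym (lookup-relabel S τ i)) (trans e (lookup-relabel S τ j))))

  module _ {τ : Fin p → Fin p} (τ-surj : StrictlySurjective _≡_ τ) where

    relabel-injective : Injective _≡_ _≡_ (λ S → relabel S τ)
    relabel-injective {S} {S′} eq = Pointwise-≡⇒≡ (ext same)
      where
        same : ∀ i → lookup S i ≡ lookup S′ i
        same i with j , refl ← τ-surj i = begin
          lookup S (τ j)          ≡⟨ lookup-relabel S τ j ⟨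
          lookup (relabel S τ) j  ≡⟨ cong (λ R → lookup R j) eq ⟩
          lookup (relabel S′ τ) j ≡⟨ lookup-relabel S′ τ j ⟩
          lookup S′ (τ j)         ∎
          where open ≡-Reasoning

    Occupied-relabel : ∀ {S v} → Occupied S v → Occupied (relabel S τ) v
    Occupied-relabel {S} (i , Si≡v) with j , refl ← τ-surj i = j , trans (lookup-relabel S τ j) Si≡v

    module _ {S S′ : Config G p} where

      private
        ρ  = lookup-relabel S τ
        ρ′ = lookup-relabel S′ τ

      PathMove-relabel : PathMove G S S′ → PathMove G (relabel S τ) (relabel S′ τ)
      PathMove-relabel pm = record
        { k         = k
        ; u         = u
        ; simple    = simple
        ; edges     = edges
        ; endFree   = λ i → endFree (τ i) ∘ trans (sym (ρ i))
        ; startFree = λ i → startFree (τ i) ∘ trans (sym (ρ′ i))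
        ; offPath   = λ i off →
                        trans (ρ′ i) (trans (offPath (τ i) (λ j → off j ∘ trans (ρ i))) (sym (ρ i)))
        ; onPath    = λ i j → trans (ρ′ i) ∘ onPath (τ i) j ∘ trans (sym (ρ i))
        }
        where open PathMove pm

      RotationMove-relabel : RotationMove G S S′ → RotationMove G (relabel S τ) (relabel S′ τ)
      RotationMove-relabel rm = record
        { m        = m
        ; u        = u
        ; simple   = simple
        ; edges    = edges
        ; occ      = Occupied-relabel {S} ∘ occ
        ; occ'     = Occupied-relabel {S′} ∘ occ'
        ; offCycle = λ i off →
                       trans (ρ′ i) (trans (offCycle (τ i) (λ j → off j ∘ trans (ρ i))) (sym (ρ i)))
        ; onCycle  = λ i j → trans (ρ′ i) ∘ onCycle (τ i) j ∘ trans (sym (ρ i))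
        }
        where open RotationMove rm

      ValidMove-relabel : Injective _≡_ _≡_ τ →
                          ValidMove G S S′ → ValidMove G (relabel S τ) (relabel S′ τ)
      ValidMove-relabel τ-inj (pathMove c c′ pm) =
        pathMove (IsConfig-relabel τ-inj {S} c) (IsConfig-relabel τ-inj {S′} c′) (PathMove-relabel pm)
      ValidMove-relabel τ-inj (rotMove c c′ rm) =
        rotMove (IsConfig-relabel τ-inj {S} c) (IsConfig-relabel τ-inj {S′} c′) (RotationMove-relabel rm)
      ValidMove-relabel τ-inj (dummy c refl) = dummy (IsConfig-relabel τ-inj {S} c) refl

    Reachable-relabel : Injective _≡_ _≡_ τ →
                        ∀ {S S′} → Reachable G S S′ → Reachable G (relabel S τ) (relabel S′ τ)
    Reachable-relabel τ-inj = Star.gmap (λ S → relabel S τ) (ValidMove-relabel τ-inj)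

-- Deciding reachability

module _ (G : Graph) {p : ℕ} where

  isConfig? : (S : Config G p) → Dec (IsConfig G S)
  isConfig? S = all? λ i → all? λ j → (lookup S i ≟ᶠ lookup S j) →-dec (i ≟ᶠ j)

  module _ (S S′ : Config G p) where

    PathMoveAlong : (k : ℕ) → (Fin (suc k) → Fin (n G)) → Set
    PathMoveAlong k u =
      (∀ a b → u a ≡ u b → a ≡ b) ×
      (∀ (j : Fin k) → Adj G (u (inject₁ j)) (u (suc j))) ×
      (∀ i → lookup S i ≢ u (fromℕ k)) ×
      (∀ i → lookup S′ i ≢ u zero) ×
      (∀ i → (∀ j → lookup S i ≢ u j) → lookup S′ i ≡ lookup S i) ×
      (∀ i (j : Fin k) → lookup S i ≡ u (inject₁ j) → lookup S′ i ≡ u (suc j))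

    pathMoveAlong? : ∀ k u → Dec (PathMoveAlong k u)
    pathMoveAlong? k u =
      (all? λ a → all? λ b → (u a ≟ᶠ u b) →-dec (a ≟ᶠ b)) ×-dec
      (all? λ j → T? (adj G (u (inject₁ j)) (u (suc j)))) ×-dec
      (all? λ i → ¬? (lookup S i ≟ᶠ u (fromℕ k))) ×-dec
      (all? λ i → ¬? (lookup S′ i ≟ᶠ u zero)) ×-dec
      (all? λ i → (all? λ j → ¬? (lookup S i ≟ᶠ u j)) →-dec (lookup S′ i ≟ᶠ lookup S i)) ×-dec
      (all? λ i → all? λ j → (lookup S i ≟ᶠ u (inject₁ j)) →-dec (lookup S′ i ≟ᶠ u (suc j)))

    PathMoveAlong-resp : ∀ k {u w} → u ≗ w → PathMoveAlong k u → PathMoveAlong k w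
    PathMoveAlong-resp k u≗w (simple , edges , endFree , startFree , offPath , onPath) =
      (λ a b e → simple a b (trans (u≗w a) (trans e (sym (u≗w b))))) ,
      (λ j → subst₂ (Adj G) (u≗w _) (u≗w _) (edges j)) ,
      (λ i e → endFree i (trans e (sym (u≗w _)))) ,
      (λ i e → startFree i (trans e (sym (u≗w _)))) ,
      (λ i off → offPath i (λ j e → off j (trans e (u≗w j)))) ,
      (λ i j e → trans (onPath i j (trans e (sym (u≗w _)))) (u≗w _))

    pathMove? : Dec (PathMove G S S′)
    pathMove? = Dec.map′ toPathMove fromPathMove
      (anyUpTo? (λ k → anyFunction? (suc k) (PathMoveAlong-resp k) (pathMoveAlong? k)) (n G))
      where
        toPathMove : (∃ λ k → k < n G × ∃ (PathMoveAlong k)) → PathMove G S S′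
        toPathMove (k , _ , u , simple , edges , endFree , startFree , offPath , onPath) =
          record { k = k ; u = u ; simple = simple ; edges = edges ; endFree = endFree
                 ; startFree = startFree ; offPath = offPath ; onPath = onPath }
        fromPathMove : PathMove G S S′ → ∃ λ k → k < n G × ∃ (PathMoveAlong k)
        fromPathMove pm =
          k , injective⇒≤ (simple _ _) , u , simple , edges , endFree , startFree , offPath , onPath
          where open PathMove pm

    RotationMoveAlong : (m : ℕ) → (Fin (3 + m) → Fin (n G)) → Set
    RotationMoveAlong m u =
      (∀ a b → u a ≡ u b → a ≡ b) ×
      (∀ j → Adj G (u j) (u (next j))) ×
      (∀ j → Occupied G S (u j)) ×
      (∀ j → Occupied G S′ (u j)) ×
      (∀ i → (∀ j → lookup S i ≢ u j) → lookup S′ i ≡ lookup S i) ×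
      (∀ i j → lookup S i ≡ u j → lookup S′ i ≡ u (next j))

    rotationMoveAlong? : ∀ m u → Dec (RotationMoveAlong m u)
    rotationMoveAlong? m u =
      (all? λ a → all? λ b → (u a ≟ᶠ u b) →-dec (a ≟ᶠ b)) ×-dec
      (all? λ j → T? (adj G (u j) (u (next j)))) ×-dec
      (all? λ j → occupied? G S (u j)) ×-dec
      (all? λ j → occupied? G S′ (u j)) ×-dec
      (all? λ i → (all? λ j → ¬? (lookup S i ≟ᶠ u j)) →-dec (lookup S′ i ≟ᶠ lookup S i)) ×-dec
      (all? λ i → all? λ j → (lookup S i ≟ᶠ u j) →-dec (lookup S′ i ≟ᶠ u (next j)))

    RotationMoveAlong-resp : ∀ m {u w} → u ≗ w → RotationMoveAlong m u → RotationMoveAlong m w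
    RotationMoveAlong-resp m u≗w (simple , edges , occ , occ' , offCycle , onCycle) =
      (λ a b e → simple a b (trans (u≗w a) (trans e (sym (u≗w b))))) ,
      (λ j → subst₂ (Adj G) (u≗w _) (u≗w _) (edges j)) ,
      (λ j → let (i , e) = occ j in i , trans e (u≗w j)) ,
      (λ j → let (i , e) = occ' j in i , trans e (u≗w j)) ,
      (λ i off → offCycle i (λ j e → off j (trans e (u≗w j)))) ,
      (λ i j e → trans (onCycle i j (trans e (sym (u≗w _)))) (u≗w _))

    rotationMove? : Dec (RotationMove G S S′)
    rotationMove? = Dec.map′ toRotationMove fromRotationMove
      (anyUpTo? (λ m → anyFunction? (3 + m) (RotationMoveAlong-resp m) (rotationMoveAlong? m)) (n G))
      where
        toRotationMove : (∃ λ m → m < n G × ∃ (RotationMoveAlong m)) → RotationMove G S S′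
        toRotationMove (m , _ , u , simple , edges , occ , occ' , offCycle , onCycle) =
          record { m = m ; u = u ; simple = simple ; edges = edges ; occ = occ ; occ' = occ'
                 ; offCycle = offCycle ; onCycle = onCycle }
        fromRotationMove : RotationMove G S S′ → ∃ λ m → m < n G × ∃ (RotationMoveAlong m)
        fromRotationMove rm =
          m , ≤-trans (m≤n+m (suc m) 2) (injective⇒≤ (simple _ _)) ,
          u , simple , edges , occ , occ' , offCycle , onCycle
          where open RotationMove rm

    ValidMove-source : ValidMove G S S′ → IsConfig G S
    ValidMove-source (pathMove c _ _) = c
    ValidMove-source (rotMove c _ _)  = c
    ValidMove-source (dummy c _)      = c

    validMove? : Dec (ValidMove G S S′)
    validMove? with isConfig? S | isConfig? S′
    ... | no ¬c | _      = no (¬c ∘ ValidMove-source)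
    ... | yes c | no ¬c′ = no (¬c′ ∘ ValidMove-target G)
    ... | yes c | yes c′ =
      Dec.map′ toValidMove fromValidMove (pathMove? ⊎-dec rotationMove? ⊎-dec ≡-dec _≟ᶠ_ S S′)
      where
        toValidMove : PathMove G S S′ ⊎ RotationMove G S S′ ⊎ S ≡ S′ → ValidMove G S S′
        toValidMove (inj₁ pm)        = pathMove c c′ pm
        toValidMove (inj₂ (inj₁ rm)) = rotMove c c′ rm
        toValidMove (inj₂ (inj₂ e))  = dummy c e
        fromValidMove : ValidMove G S S′ → PathMove G S S′ ⊎ RotationMove G S S′ ⊎ S ≡ S′
        fromValidMove (pathMove _ _ pm) = inj₁ pm
        fromValidMove (rotMove _ _ rm)  = inj₂ (inj₁ rm)
        fromValidMove (dummy _ e)       = inj₂ (inj₂ e)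

  configurations : List (Config G p)
  configurations = filter isConfig? (allVecs (allFin (n G)) p)

  ∈-configurations⁺ : ∀ {S} → IsConfig G S → S ∈ configurations
  ∈-configurations⁺ {S} = ∈-filter⁺ isConfig? (∈-allVecs ∈-allFin S)

  ∈-configurations⁻ : ∀ {S} → S ∈ configurations → IsConfig G S
  ∈-configurations⁻ = proj₂ ∘ ∈-filter⁻ isConfig? {xs = allVecs (allFin (n G)) p}

  Unique-configurations : Unique configurations
  Unique-configurations = filter⁺ isConfig? (Unique-allVecs (allFin⁺ (n G)) p)

  length≤length-configurations : ∀ {M} → Unique M → All (IsConfig G) M → length M ≤ length configurations
  length≤length-configurations M! M-configs =
    Unique⇒length≤ (≡-dec _≟ᶠ_) M! (∈-configurations⁺ ∘ All.lookup M-configs)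

  reachable? : ∀ S S′ → Dec (Reachable G S S′)
  reachable? = Star? (≡-dec _≟ᶠ_) validMove? configurations (∈-configurations⁺ ∘ ValidMove-target G)

-- Sliding robots along walks

module _ (G : Graph) {p : ℕ} where

  record Relocation (S S′ : Config G p) (a b : Fin (n G)) : Set where
    field
      occupied⁻ : ∀ {v} → Occupied G S′ v → (Occupied G S v × v ≢ a) ⊎ v ≡ b
      occupied⁺ : ∀ {v} → Occupied G S v → v ≢ a → Occupied G S′ v
      target    : Occupied G S′ b

  open Relocation

  Relocation-vacant : ∀ {S S′ a b v} → Relocation S S′ a b →
                      v ≢ b → ¬ Occupied G S v → ¬ Occupied G S′ v
  Relocation-vacant rel v≢b v-free v-occ′ with occupied⁻ rel v-occ′
  ... | inj₁ (v-occ , _) = v-free v-occ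
  ... | inj₂ v≡b         = v≢b v≡b

  Relocation-vacates : ∀ {S S′ a b} → Relocation S S′ a b → a ≢ b → ¬ Occupied G S′ a
  Relocation-vacates rel a≢b a-occ′ with occupied⁻ rel a-occ′
  ... | inj₁ (_ , a≢a) = a≢a refl
  ... | inj₂ a≡b       = a≢b a≡b

  Relocation-via-vacant : ∀ {S S₁ S₂ a w b} → ¬ Occupied G S w →
    Relocation S S₁ a w → Relocation S₁ S₂ w b → Relocation S S₂ a b
  Relocation-via-vacant {S} {S₁} {S₂} {a} {w} {b} w-free rel₁ rel₂ = record
    { occupied⁻ = occupied⁻′
    ; occupied⁺ = λ v-occ v≢a →
                    occupied⁺ rel₂ (occupied⁺ rel₁ v-occ v≢a) (λ { refl → w-free v-occ })
    ; target    = target rel₂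
    }
    where
      occupied⁻′ : ∀ {v} → Occupied G S₂ v → (Occupied G S v × v ≢ a) ⊎ v ≡ b
      occupied⁻′ v-occ₂ with occupied⁻ rel₂ v-occ₂
      ... | inj₂ v≡b = inj₂ v≡b
      ... | inj₁ (v-occ₁ , v≢w) with occupied⁻ rel₁ v-occ₁
      ...   | inj₁ old = inj₁ old
      ...   | inj₂ v≡w = contradiction v≡w v≢w

  Relocation-via-occupied : ∀ {S S₁ S₂ a w b} →
    Occupied G S a → Occupied G S w → a ≢ w → ¬ Occupied G S b →
    Relocation S S₁ w b → Relocation S₁ S₂ a w → Relocation S S₂ a b
  Relocation-via-occupied {S} {S₁} {S₂} {a} {w} {b} a-occ w-occ a≢w b-free rel₁ rel₂ = record
    { occupied⁻ = occupied⁻′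
    ; occupied⁺ = occupied⁺′
    ; target    = occupied⁺ rel₂ (target rel₁) (λ { refl → b-free a-occ })
    }
    where
      occupied⁻′ : ∀ {v} → Occupied G S₂ v → (Occupied G S v × v ≢ a) ⊎ v ≡ b
      occupied⁻′ v-occ₂ with occupied⁻ rel₂ v-occ₂
      ... | inj₂ refl = inj₁ (w-occ , a≢w ∘ sym)
      ... | inj₁ (v-occ₁ , v≢a) with occupied⁻ rel₁ v-occ₁
      ...   | inj₁ (v-occ , _) = inj₁ (v-occ , v≢a)
      ...   | inj₂ v≡b         = inj₂ v≡b
      occupied⁺′ : ∀ {v} → Occupied G S v → v ≢ a → Occupied G S₂ v
      occupied⁺′ {v} v-occ v≢a with v ≟ᶠ w
      ... | yes refl = target rel₂
      ... | no v≢w   = occupied⁺ rel₂ (occupied⁺ rel₁ v-occ v≢w) v≢a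

  slide : ∀ {S x y} → IsConfig G S → Occupied G S x → Adj G x y → ¬ Occupied G S y →
          ∃ λ S′ → ValidMove G S S′ × Relocation S S′ x y
  slide {S} {y = y} c (r , refl) x~y y-free = S′ , pathMove c c′ pm , rel
    where
      x  = lookup S r
      S′ = S [ r ]≔ y

      x≢y : x ≢ y
      x≢y = Adj⇒≢ G x~y

      updated : ∀ i → (i ≡ r × lookup S′ i ≡ y) ⊎ (i ≢ r × lookup S′ i ≡ lookup S i)
      updated i with i ≟ᶠ r
      ... | yes refl = inj₁ (refl , lookup∘update r S y)
      ... | no i≢r   = inj₂ (i≢r , lookup∘update′ i≢r S y)

      c′ : IsConfig G S′
      c′ i j e with updated i | updated j
      ... | inj₁ (refl , _)   | inj₁ (refl , _)   = refl
      ... | inj₁ (_ , i↦y)    | inj₂ (_ , j-same) =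
        contradiction (j , trans (sym j-same) (trans (sym e) i↦y)) y-free
      ... | inj₂ (_ , i-same) | inj₁ (_ , j↦y)    =
        contradiction (i , trans (sym i-same) (trans e j↦y)) y-free
      ... | inj₂ (_ , i-same) | inj₂ (_ , j-same) = c i j (trans (sym i-same) (trans e j-same))

      u : Fin 2 → Fin (n G)
      u = lookup (x ∷ y ∷ [])

      pm : PathMove G S S′
      pm = record
        { k         = 1
        ; u         = u
        ; simple    = λ { zero zero _ → refl ; zero (suc zero) e → contradiction e x≢y
                        ; (suc zero) zero e → contradiction (sym e) x≢y ; (suc zero) (suc zero) _ → refl }
        ; edges     = λ { zero → x~y }
        ; endFree   = λ i e → y-free (i , e)
        ; startFree = startFree
        ; offPath   = offPath
        ; onPath    = λ { i zero e → subst (λ i → lookup S′ i ≡ y) (sym (c i r e)) (lookup∘update r S y) }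
        }
        where
          startFree : ∀ i → lookup S′ i ≢ x
          startFree i e with updated i
          ... | inj₁ (_ , i↦y)      = x≢y (trans (sym e) i↦y)
          ... | inj₂ (i≢r , i-same) = i≢r (c i r (trans (sym i-same) e))
          offPath : ∀ i → (∀ j → lookup S i ≢ u j) → lookup S′ i ≡ lookup S i
          offPath i off with updated i
          ... | inj₁ (refl , _)  = contradiction refl (off zero)
          ... | inj₂ (_ , i-same) = i-same

      rel : Relocation S S′ x y
      rel = record
        { occupied⁻ = occupied⁻′
        ; occupied⁺ = occupied⁺′
        ; target    = r , lookup∘update r S y
        }
        where
          occupied⁻′ : ∀ {v} → Occupied G S′ v → (Occupied G S v × v ≢ x) ⊎ v ≡ y
          occupied⁻′ (i , e) with updated i
          ... | inj₁ (_ , i↦y)      = inj₂ (trans (sym e) i↦y)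
          ... | inj₂ (i≢r , i-same) =
            inj₁ ((i , trans (sym i-same) e) , λ v≡x → i≢r (c i r (trans (sym i-same) (trans e v≡x))))
          occupied⁺′ : ∀ {v} → Occupied G S v → v ≢ x → Occupied G S′ v
          occupied⁺′ (i , e) v≢x with updated i
          ... | inj₁ (refl , _)   = contradiction (sym e) v≢x
          ... | inj₂ (_ , i-same) = i , trans i-same e

  -- If the next vertex w of the walk is free, slide the robot from a to w and continue from w;
  -- otherwise first relocate the robot at w to b, which frees w, and then slide a into w.
  relocate : ∀ {a b} → Star (Adj G) a b → ∀ {S} → IsConfig G S → Occupied G S a → ¬ Occupied G S b →
             ∃ λ S′ → Reachable G S S′ × Relocation S S′ a b
  relocate ε _ a-occ b-free = contradiction a-occ b-free
  relocate {a} {b} (_◅_ {j = w} a~w w⇝b) {S} c a-occ b-free with occupied? G S w | w ≟ᶠ b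
  ... | no w-free | yes refl with S₁ , mv , rel ← slide c a-occ a~w w-free = S₁ , mv ◅ ε , rel
  ... | no w-free | no w≢b
    with S₁ , mv , rel₁ ← slide c a-occ a~w w-free
    with S₂ , mvs , rel₂ ← relocate w⇝b (ValidMove-target G mv) (target rel₁)
                                     (Relocation-vacant rel₁ (w≢b ∘ sym) b-free)
    = S₂ , mv ◅ mvs , Relocation-via-vacant w-free rel₁ rel₂
  ... | yes w-occ | _
    with S₁ , mvs , rel₁ ← relocate w⇝b c w-occ b-free
    with S₂ , mv , rel₂ ← slide (Reachable-IsConfig G c mvs) (occupied⁺ rel₁ a-occ (Adj⇒≢ G a~w)) a~w
                                (Relocation-vacates rel₁ λ { refl → b-free w-occ })
    = S₂ , mvs ◅◅ mv ◅ ε , Relocation-via-occupied a-occ w-occ (Adj⇒≢ G a~w) b-free rel₁ rel₂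

  Within : Config G p → Config G p → Set
  Within S T = ∀ i → Occupied G T (lookup S i)

  within? : ∀ S T → Dec (Within S T)
  within? S T = all? λ i → occupied? G T (lookup S i)

  Within-sym : ∀ {S T} → IsConfig G T → Within T S → Within S T
  Within-sym {S} {T} T-config T⊆S i =
    let j , gj≡i = injective⇒strictlySurjective g-inj i
    in  j , trans (sym (proj₂ (T⊆S j))) (cong (lookup S) gj≡i)
    where
      g : Fin p → Fin p
      g = proj₁ ∘ T⊆S
      g-inj : Injective _≡_ _≡_ g
      g-inj {a} {b} ga≡gb =
        T-config a b (trans (sym (proj₂ (T⊆S a))) (trans (cong (lookup S) ga≡gb) (proj₂ (T⊆S b))))

  Within⇒relabel : ∀ {X S} → IsConfig G X → Within X S →
    ∃ λ τ → Injective _≡_ _≡_ τ × StrictlySurjective _≡_ τ × X ≡ relabel G S τ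
  Within⇒relabel {X} {S} X-config X⊆S = τ , τ-inj , injective⇒strictlySurjective τ-inj ,
    Pointwise-≡⇒≡ (ext λ i → trans (X≗Sτ i) (sym (lookup-relabel G S τ i)))
    where
      τ : Fin p → Fin p
      τ = proj₁ ∘ X⊆S
      X≗Sτ : ∀ i → lookup X i ≡ lookup S (τ i)
      X≗Sτ i = sym (proj₂ (X⊆S i))
      τ-inj : Injective _≡_ _≡_ τ
      τ-inj {a} {b} τa≡τb = X-config a b (trans (X≗Sτ a) (trans (cong (lookup S) τa≡τb) (sym (X≗Sτ b))))

  module _ (connected : Connected G) {I : Config G p} (I-config : IsConfig G I) where

    occupy : ∀ {S} → IsConfig G S → ∀ j → ∃ λ S′ → Reachable G S S′ × Occupied G S′ (lookup I j) ×
             (∀ {j′} → Occupied G S (lookup I j′) → Occupied G S′ (lookup I j′))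
    occupy {S} c j with occupied? G S (lookup I j)
    ... | yes occ = S , ε , occ , λ occ′ → occ′
    ... | no free with within? S I
    ...   | yes S⊆I = contradiction (Within-sym {I} {S} c S⊆I j) free
    ...   | no S⊈I
      with r , r-out ← ¬∀⟶∃¬ p _ (λ i → occupied? G I (lookup S i)) S⊈I
      with S′ , mvs , rel ← relocate (connected (lookup S r) (lookup I j)) c (r , refl) free
      = S′ , mvs , target rel , λ {j′} occ′ → occupied⁺ rel occ′ (r-out ∘ (j′ ,_))

    occupyAll : ∀ (js : List (Fin p)) {S} → IsConfig G S →
                ∃ λ S′ → Reachable G S S′ × All (Occupied G S′ ∘ lookup I) js
    occupyAll []       c = _ , ε , []
    occupyAll (j ∷ js) c
      with S₁ , mvs₁ , occs₁ ← occupyAll js c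
      with S₂ , mvs₂ , occ₂ , keep ← occupy (Reachable-IsConfig G c mvs₁) j
      = S₂ , mvs₁ ◅◅ mvs₂ , occ₂ ∷ All.map keep occs₁

    gather : ∀ {S} → IsConfig G S → ∃ λ S′ → Reachable G S S′ × Within S′ I
    gather c with S′ , mvs , occs ← occupyAll (allFin p) c =
      S′ , mvs , Within-sym {S′} {I} I-config (λ j → All.lookup occs (∈-allFin j))

-- Counting unreachable configurations

module _ (G : Graph) {p : ℕ} (I : Config G p) where

  unreachables : List (Config G p)
  unreachables = filter (∁? (reachable? G I)) (configurations G)

  Unique-unreachables : Unique unreachables
  Unique-unreachables = filter⁺ (∁? (reachable? G I)) (Unique-configurations G)

  ∈-unreachables⁻ : ∀ {S} → S ∈ unreachables → IsConfig G S × ¬ Reachable G I S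
  ∈-unreachables⁻ S∈
    with S∈configs , ¬I⇝S ← ∈-filter⁻ (∁? (reachable? G I)) {xs = configurations G} S∈ =
    ∈-configurations⁻ G S∈configs , ¬I⇝S

  unreachableRelabelling : Connected G → IsConfig G I → ¬ UniversallySolvable G p →
    ∃ λ τ → Injective _≡_ _≡_ τ × StrictlySurjective _≡_ τ × ¬ Reachable G I (relabel G I τ)
  unreachableRelabelling connected I-config ¬solvable
    with Any.any? (λ X → within? G X I ×-dec ¬? (reachable? G I X)) (configurations G)
  ... | yes found
    with X , X∈ , X⊆I , ¬I⇝X ← find found
    with τ , τ-inj , τ-surj , X≡Iτ ← Within⇒relabel G {X = X} {S = I} (∈-configurations⁻ G X∈) X⊆I
    = τ , τ-inj , τ-surj , subst (¬_ ∘ Reachable G I) X≡Iτ ¬I⇝X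
  ... | no none = contradiction solvable ¬solvable
    where
      toI : ∀ {S} → IsConfig G S → Reachable G S I
      toI {S} c with X , S⇝X , X⊆I ← gather G connected {I} I-config {S} c with reachable? G I X
      ... | yes I⇝X = S⇝X ◅◅ Reachable-sym G I⇝X
      ... | no ¬I⇝X =
        contradiction (Any.map (λ { refl → X⊆I , ¬I⇝X })
                               (∈-configurations⁺ G {S = X} (Reachable-IsConfig G c S⇝X)))
                      none
      solvable : UniversallySolvable G p
      solvable S T cS cT = toI cS ◅◅ Reachable-sym G (toI cT)

  length-configurations≡length-unreachables : ¬ IsConfig G I →
                                              length (configurations G {p}) ≡ length unreachables
  length-configurations≡length-unreachables ¬I-config =
    sym (cong length (filter-all (∁? (reachable? G I)) (All.tabulate unreachable)))
    where
      unreachable : ∀ {S} → S ∈ configurations G → ¬ Reachable G I S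
      unreachable S∈ I⇝S = ¬I-config (Reachable-IsConfig G (∈-configurations⁻ G S∈) (Reachable-sym G I⇝S))

  length-configurations≤2*length-unreachables : Connected G → IsConfig G I → ¬ UniversallySolvable G p →
    length (configurations G {p}) ≤ 2 * length unreachables
  length-configurations≤2*length-unreachables connected I-config ¬solvable
    with τ , τ-inj , τ-surj , ¬I⇝Iτ ← unreachableRelabelling connected I-config ¬solvable =
    length≤2*length-filter-∁ (reachable? G I) (≡-dec _≟ᶠ_) (λ S → relabel G S τ)
      (relabel-injective G τ-surj) (Unique-configurations G) swap
    where
      swap : ∀ {S} → S ∈ configurations G → Reachable G I S →
             relabel G S τ ∈ configurations G × ¬ Reachable G I (relabel G S τ)
      swap {S} S∈ I⇝S =
        ∈-configurations⁺ G (IsConfig-relabel G τ-inj {S} (∈-configurations⁻ G S∈)) ,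
        λ I⇝Sτ → ¬I⇝Iτ (I⇝Sτ ◅◅ Reachable-sym G (Reachable-relabel G τ-surj τ-inj I⇝S))

lemma15 : (G : Graph) → Connected G → (p : ℕ) → 2 ≤ p → (p≤n : p ≤ n G) →
          ¬ UniversallySolvable G p →
          Σ (List (Config G p)) λ L →
            Unique L × All (IsConfig G) L ×
            All (λ S → ¬ Reachable G (identityConfig G p p≤n) S) L ×
            (∀ (M : List (Config G p)) → Unique M → All (IsConfig G) M →
               length M ≤ 2 * length L)
lemma15 G connected p _ p≤n ¬solvable =
  unreachables G I ,
  Unique-unreachables G I ,
  All.tabulate (proj₁ ∘ ∈-unreachables⁻ G I) ,
  All.tabulate (proj₂ ∘ ∈-unreachables⁻ G I) ,
  λ M M! M-configs → ≤-trans (length≤length-configurations G M! M-configs) (half (isConfig? G I))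
  where
    I = identityConfig G p p≤n
    -- S_I is a configuration when G is connected (BFS visits distinct vertices); rather than prove
    -- this about BFS we also treat the other case, where nothing at all is reachable from S_I.
    half : Dec (IsConfig G I) → length (configurations G {p}) ≤ 2 * length (unreachables G I)
    half (yes I-config) = length-configurations≤2*length-unreachables G I connected I-config ¬solvable
    half (no ¬I-config) =
      ≤-trans (≤-reflexive (length-configurations≡length-unreachables G I ¬I-config)) (m≤m+n _ _)
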